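{- Let $m>1$ be an integer and let $F$ be a bipartite directed $2$-factor of order $2m$. There exists an $F$-factorization of $H_{2m}^*$.
   Context: A directed $2$-factor $[m_1,\ldots,m_t]$ of order $m_1+\cdots+m_t$ is a digraph consisting of vertex-disjoint directed cycles of lengths $m_1,\ldots,m_t$ (each $m_i\ge2$; a directed $2$-cycle on $\{u,v\}$ consists of arcs $uv$ and $vu$); it is bipartite if all $m_i$ are even. $H_{2m}$ is the lexicographic product $C_m[\overline{K_2}]$: vertex set $\{x_i,y_i : i\in\mathbb{Z}_m\}$, with each of $x_i,y_i$ adjacent to each of $x_{i+1},y_{i+1}$ (indices mod $m$), $C_m$ being the cycle on $\mathbb{Z}_m$. For a graph $G$, $G^*$ is the digraph obtained by replacing each edge $\{u,v\}$ by the arcs $uv$ and $vu$. An $F$-factorization of a digraph $D$ is a partition of the arc set of $D$ into spanning subdigraphs each isomorphic to $F$. -}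

module Defs where

open import Data.Nat using (ℕ; zero; suc; _≤_; _*_)
open import Data.Nat.Divisibility using (_∣_)
open import Data.Fin using (Fin; toℕ)
open import Data.Bool using (Bool)
open import Data.List using (List; length; lookup)
open import Data.List.Relation.Unary.All using (All)
open import Data.Product using (Σ; _×_; _,_; ∃-syntax)
open import Data.Sum using (_⊎_)
open import Relation.Binary.PropositionalEquality using (_≡_)
open import Function.Bundles using (_⤖_; Bijection; _⇔_)

Digraph : Set → Set₁
Digraph V = V → V → Set

SucMod : {n : ℕ} → Fin n → Fin n → Set
SucMod {n} i j = (suc (toℕ i) ≡ toℕ j) ⊎ (suc (toℕ i) ≡ n × toℕ j ≡ 0)

CycleAdj : {m : ℕ} → Fin m → Fin m → Set
CycleAdj i j = SucMod i j ⊎ SucMod j i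

-- Vertices of H_{2m}: (i , false) = x_i , (i , true) = y_i.
HVert : ℕ → Set
HVert m = Fin m × Bool

-- H_{2m}^* = (C_m[K̄_2])^* : arcs in both directions of every edge of H_{2m}.
HStarArc : (m : ℕ) → Digraph (HVert m)
HStarArc m (i , _) (j , _) = CycleAdj i j

-- The directed 2-factor [m_1,...,m_t] given as a list of cycle lengths:
-- vertices (k , a) with a ∈ Z_{m_k}, arcs (k , a) → (k , a+1 mod m_k).
FVert : List ℕ → Set
FVert ms = Σ (Fin (length ms)) (λ k → Fin (lookup ms k))

FArc : (ms : List ℕ) → Digraph (FVert ms)
FArc ms (k , a) (k' , b) = Σ (k ≡ k') (λ { _≡_.refl → SucMod a b })

Is2FactorType : List ℕ → Set
Is2FactorType ms = All (λ mi → 2 ≤ mi) ms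

IsBipartite : List ℕ → Set
IsBipartite ms = All (λ mi → 2 ∣ mi) ms

Isomorphic : {V W : Set} → Digraph V → Digraph W → Set
Isomorphic {V} {W} D E =
  Σ (W ⤖ V) (λ φ → ∀ a b → D (Bijection.to φ a) (Bijection.to φ b) ⇔ E a b)

Factorization : {V W : Set} → Digraph V → Digraph W → Set₁
Factorization {V} D F =
  Σ ℕ λ r → Σ (Fin r → Digraph V) λ Ds →
      (∀ j → ∀ u v → Ds j u v → D u v)
    × (∀ u v → D u v → ∃[ j ] (Ds j u v × (∀ j' → Ds j' u v → j' ≡ j)))
    × (∀ j → Isomorphic (Ds j) F)

{-# OPTIONS --safe #-}
module Submission where

-- Write the cycle lengths of F as 2h₁, …, 2hₜ, so that h₁ + ⋯ + hₜ = m, and cut the columns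
-- ℤ_m of H_{2m} into consecutive blocks of h₁, …, hₜ columns. Running right along the x-row
-- of a block and back along its y-row, the two rows shifted against each other by one column,
-- gives a directed cycle of length 2hᵢ in H*_{2m}. Together these cycles form a permutation f
-- of V(H_{2m}) whose functional digraph is F, and which sends one vertex of every column to
-- the next column and the other one to the previous column. Conjugating f by an involution
-- that swaps xᵢ and yᵢ in a chosen set of columns gives another copy of F in H*_{2m}. For
-- m ≥ 3, colour C_m properly with three colours and use the three nonzero linear forms on
-- 𝔽₂² ≅ Fin 4 as the swap patterns of the colours: an arc (i , b) → (k , e) then lies in
-- exactly one of the four conjugates, since the forms of the two distinct colours of i and k
-- take every pair of values exactly once. For m = 2 both neighbours of a column coincide, and
-- f together with its conjugate by the swap of column 0 suffices.

open import Defs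
open import Data.Bool using (Bool; true; false; not; _xor_; _∧_; if_then_else_)
open import Data.Bool.Properties as Bool using (xor-assoc; xor-same; xor-identityʳ; not-¬; ¬-not)
open import Data.Empty using (⊥-elim)
open import Data.Fin using (Fin; zero; suc; toℕ; fromℕ<; opposite)
open import Data.Fin.Properties using (toℕ-injective; toℕ<n; toℕ-fromℕ<)
open import Data.List using (List; []; _∷_; map)
open import Data.List.Relation.Unary.All using (All; []; _∷_)
open import Data.Nat using (ℕ; zero; suc; pred; _+_; _*_; _∸_; _≤_; _<_; _≟_; _<?_; z≤n; s≤s; z<s; NonZero; >-nonZero)
open import Data.Nat.DivMod using (_mod_; _%_; m<n⇒m%n≡m; n%n≡0)
open import Data.Nat.Divisibility using (divides)
open import Data.Nat.ListAction using (sum)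
open import Data.Nat.Properties
open import Data.Product using (Σ; _×_; _,_; proj₁; proj₂; ∃-syntax)
open import Data.Product.Properties using (,-injectiveˡ; ×-≡,≡→≡)
open import Data.Sum using (_⊎_; inj₁; inj₂)
open import Data.Vec as Vec using (_∷_; [])
open import Function using (_∘_)
open import Function.Bundles using (_⤖_; Bijection; _⇔_; mk⤖; mk⇔; mk↔ₛ′)
open import Function.Consequences.Propositional using (strictlySurjective⇒surjective)
open import Function.Construct.Composition using (_⤖-∘_; _⇔-∘_)
open import Function.Definitions using (Injective)
open import Function.Properties.Inverse using (↔⇒⤖)
open import Relation.Nullary using (¬_; Dec; does; yes; no; contradiction)
open import Relation.Binary.PropositionalEquality

private
  variable
    n m : ℕ
    V W : Set

-- Successor in ℤ_n

-- SucMod i j unfolds to SucModℕ n (toℕ i) (toℕ j).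
SucModℕ : ℕ → ℕ → ℕ → Set
SucModℕ n x y = (suc x ≡ y) ⊎ (suc x ≡ n × y ≡ 0)

SucModℕ-functional : ∀ {x y y'} → y < n → y' < n → SucModℕ n x y → SucModℕ n x y' → y ≡ y'
SucModℕ-functional _   _    (inj₁ refl)        (inj₁ refl)        = refl
SucModℕ-functional y<n _    (inj₁ refl)        (inj₂ (x+1≡n , _)) = contradiction y<n (<-irrefl x+1≡n)
SucModℕ-functional _   y'<n (inj₂ (x+1≡n , _)) (inj₁ refl)        = contradiction y'<n (<-irrefl x+1≡n)
SucModℕ-functional _   _    (inj₂ (_ , y≡0))   (inj₂ (_ , y'≡0))  = trans y≡0 (sym y'≡0)

SucModℕ-injective : ∀ {x x' y} → SucModℕ n x y → SucModℕ n x' y → x ≡ x'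
SucModℕ-injective (inj₁ e)         (inj₁ e')         = suc-injective (trans e (sym e'))
SucModℕ-injective (inj₁ e)         (inj₂ (_ , y≡0))  = contradiction (trans e y≡0) 1+n≢0
SucModℕ-injective (inj₂ (_ , y≡0)) (inj₁ e')         = contradiction (trans e' y≡0) 1+n≢0
SucModℕ-injective (inj₂ (e , _))   (inj₂ (e' , _))   = suc-injective (trans e (sym e'))

SucModℕ-asymmetric : ∀ {x y} → 2 < n → SucModℕ n x y → ¬ SucModℕ n y x
SucModℕ-asymmetric {x = x} _ (inj₁ refl) (inj₁ e) = <-irrefl (sym e) (<-trans (n<1+n x) (n<1+n (suc x)))
SucModℕ-asymmetric 2<n (inj₁ refl)        (inj₂ (e , refl)) = <-irrefl e 2<n
SucModℕ-asymmetric 2<n (inj₂ (e , refl))  (inj₁ refl)       = <-irrefl e 2<n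
SucModℕ-asymmetric 2<n (inj₂ (1≡n , refl)) (inj₂ (_ , refl)) = contradiction (subst (2 <_) (sym 1≡n) 2<n) λ { (s≤s ()) }

SucMod-functional : {i j j' : Fin n} → SucMod i j → SucMod i j' → j ≡ j'
SucMod-functional {j = j} {j'} s s' = toℕ-injective (SucModℕ-functional (toℕ<n j) (toℕ<n j') s s')

SucMod-injective : {i i' j : Fin n} → SucMod i j → SucMod i' j → i ≡ i'
SucMod-injective s s' = toℕ-injective (SucModℕ-injective s s')

module _ .{{_ : NonZero m}} where

  toℕ-mod : ∀ {x} → x < m → toℕ (x mod m) ≡ x
  toℕ-mod x<m = trans (toℕ-fromℕ< _) (m<n⇒m%n≡m x<m)

  SucModℕ-mod : ∀ {x} → x < m → SucModℕ m x (toℕ (suc x mod m))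
  SucModℕ-mod x<m with m≤n⇒m<n∨m≡n x<m
  ... | inj₁ x+1<m = inj₁ (sym (toℕ-mod x+1<m))
  ... | inj₂ x+1≡m = inj₂ (x+1≡m , trans (toℕ-fromℕ< _) (trans (cong (_% m) x+1≡m) (n%n≡0 m)))

sucMod : Fin n → Fin n
sucMod {suc n} i = suc (toℕ i) mod suc n

SucMod-sucMod : (i : Fin n) → SucMod i (sucMod i)
SucMod-sucMod {suc n} i = SucModℕ-mod (toℕ<n i)

sucMod-injective : Injective _≡_ _≡_ (sucMod {n})
sucMod-injective {x = i} {i'} same = SucMod-injective (SucMod-sucMod i) (subst (SucMod i') (sym same) (SucMod-sucMod i'))

-- Functional digraphs and their conjugates

Graph : (V → V) → Digraph V
Graph f u v = f u ≡ v

functional-factorization : {D : Digraph V} {F : Digraph W} (r : ℕ) (fs : Fin r → V → V) →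
  (∀ j → Isomorphic (Graph (fs j)) F) →
  (∀ j u → D u (fs j u)) →
  (∀ u v → D u v → ∃[ j ] fs j u ≡ v) →
  (∀ u {j j'} → fs j u ≡ fs j' u → j ≡ j') →
  Factorization D F
functional-factorization {D = D} r fs iso arcs covers separates =
  r , Graph ∘ fs , (λ j u v fu≡v → subst (D u) fu≡v (arcs j u)) , uniquely-covers , iso
  where
  uniquely-covers : ∀ u v → D u v → ∃[ j ] (fs j u ≡ v × (∀ j' → fs j' u ≡ v → j' ≡ j))
  uniquely-covers u v uv with covers u v uv
  ... | j , fu≡v = j , fu≡v , λ j' f'u≡v → separates u (trans f'u≡v (sym fu≡v))

conjugate : (V → V) → (V → V) → V → V
conjugate τ f = τ ∘ f ∘ τ

conjugate-isomorphic : {F : Digraph W} {f : V → V} (τ : V → V) → (∀ u → τ (τ u) ≡ u) →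
                       Isomorphic (Graph f) F → Isomorphic (Graph (conjugate τ f)) F
conjugate-isomorphic {f = f} τ τ-involutive (φ , arcs) =
  ↔⇒⤖ (mk↔ₛ′ τ τ τ-involutive τ-involutive) ⤖-∘ φ ,
  λ a b → arcs a b ⇔-∘ conjugated-arc (Bijection.to φ a) (Bijection.to φ b)
  where
  τ-injective : ∀ {u v} → τ u ≡ τ v → u ≡ v
  τ-injective {u} {v} e = trans (sym (τ-involutive u)) (trans (cong τ e) (τ-involutive v))
  conjugated-arc : ∀ u v → (conjugate τ f (τ u) ≡ τ v) ⇔ (f u ≡ v)
  conjugated-arc u v = mk⇔ (λ e → trans (cong f (sym (τ-involutive u))) (τ-injective e))
                           (λ e → cong τ (trans (cong f (τ-involutive u)) e))

next : {ms : List ℕ} → FVert ms → FVert ms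
next (k , a) = k , sucMod a

FArc⇒next : ∀ {ms} {a b : FVert ms} → FArc ms a b → next {ms} a ≡ b
FArc⇒next {a = k , a} {.k , b} (refl , a→b) = cong (k ,_) (SucMod-functional (SucMod-sucMod a) a→b)

next⇒FArc : ∀ {ms} {a b : FVert ms} → next {ms} a ≡ b → FArc ms a b
next⇒FArc {a = k , a} refl = refl , SucMod-sucMod a

next-injective : ∀ {ms} → Injective _≡_ _≡_ (next {ms})
next-injective {_} {k , a} {k' , a'} e with ,-injectiveˡ e
... | refl = cong (k ,_) (sucMod-injective (toℕ-injective (cong (toℕ ∘ proj₂) e)))

module _ {ms : List ℕ} {f : V → V} (φ : FVert ms ⤖ V) (intertwines : ∀ a → f (Bijection.to φ a) ≡ Bijection.to φ (next {ms} a)) where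
  open Bijection φ using (to; injective; strictlySurjective)

  intertwining-isomorphic : Isomorphic (Graph f) (FArc ms)
  intertwining-isomorphic = φ , λ a b →
    mk⇔ (λ e → next⇒FArc {ms} (injective (trans (sym (intertwines a)) e)))
        (λ arc → trans (intertwines a) (cong to (FArc⇒next {ms} arc)))

  intertwining-injective : Injective _≡_ _≡_ f
  intertwining-injective {u} {u'} fu≡fu' with strictlySurjective u | strictlySurjective u'
  ... | a , refl | a' , refl =
    cong to (next-injective {ms} (injective (trans (sym (intertwines a)) (trans fu≡fu' (intertwines a')))))

-- Factorizations of H*_{2m} by conjugates of a permutation

xor-involutiveˡ : ∀ x y → x xor (x xor y) ≡ y
xor-involutiveˡ x y = trans (sym (xor-assoc x x y)) (cong (_xor y) (xor-same x))

xor-involutiveʳ : ∀ x y → (x xor y) xor y ≡ x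
xor-involutiveʳ x y = trans (xor-assoc x y y) (trans (cong (x xor_) (xor-same y)) (xor-identityʳ x))

xor-cancelʳ : ∀ {x y z} → x xor z ≡ y xor z → x ≡ y
xor-cancelʳ {x} {y} {z} e = begin
  x                ≡⟨ sym (xor-involutiveʳ x z) ⟩
  (x xor z) xor z  ≡⟨ cong (_xor z) e ⟩
  (y xor z) xor z  ≡⟨ xor-involutiveʳ y z ⟩
  y                ∎
  where open ≡-Reasoning

column : HVert m → Fin m
column = proj₁

flip : (Fin m → Bool) → HVert m → HVert m
flip s u = column u , s (column u) xor proj₂ u

flip-involutive : (s : Fin m → Bool) (u : HVert m) → flip s (flip s u) ≡ u
flip-involutive s (i , b) = cong (i ,_) (xor-involutiveˡ (s i) b)

flip-at : ∀ {s : Fin m → Bool} {w k} → column w ≡ k → flip s w ≡ (k , s k xor proj₂ w)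
flip-at refl = refl

flip-fixes : ∀ {s : Fin m → Bool} {w} → s (column w) ≡ false → flip s w ≡ w
flip-fixes {w = w} sw≡false = cong (λ x → column w , x xor proj₂ w) sw≡false

flip-moves : ∀ {s : Fin m → Bool} {w} → s (column w) ≡ true → flip s w ≢ w
flip-moves {w = w} sw≡true flip≡w =
  not-¬ refl (sym (trans (cong (_xor proj₂ w) (sym sw≡true)) (cong proj₂ flip≡w)))

Betweenℕ : ℕ → ℕ → ℕ → ℕ → Set
Betweenℕ n y x z = (SucModℕ n y x × SucModℕ n x z) ⊎ (SucModℕ n z x × SucModℕ n x y)

record SplitsColumns (f : HVert m → HVert m) : Set where
  constructor splits
  field between : ∀ i → Betweenℕ m (toℕ (column (f (i , false)))) (toℕ i) (toℕ (column (f (i , true))))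

module _ {f : HVert m → HVert m} (split : SplitsColumns f) where
  open SplitsColumns split

  splits⇒adjacent : ∀ u → CycleAdj (column u) (column (f u))
  splits⇒adjacent (i , false) with between i
  ... | inj₁ (x→i , _) = inj₂ x→i
  ... | inj₂ (_ , i→x) = inj₁ i→x
  splits⇒adjacent (i , true) with between i
  ... | inj₁ (_ , i→y) = inj₁ i→y
  ... | inj₂ (y→i , _) = inj₂ y→i

  splits⇒reaches : ∀ {i k} → CycleAdj i k → ∃[ p ] column (f (i , p)) ≡ k
  splits⇒reaches {i} (inj₁ i→k) with between i
  ... | inj₁ (_ , i→y) = true , SucMod-functional i→y i→k
  ... | inj₂ (_ , i→x) = false , SucMod-functional i→x i→k
  splits⇒reaches {i} (inj₂ k→i) with between i
  ... | inj₁ (x→i , _) = false , SucMod-injective x→i k→i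
  ... | inj₂ (y→i , _) = true , SucMod-injective y→i k→i

  splits⇒separates : 2 < m → ∀ {i} → column (f (i , false)) ≢ column (f (i , true))
  splits⇒separates m>2 {i} x≡y with between i
  ... | inj₁ (x→i , i→y) = SucModℕ-asymmetric m>2 x→i (subst (SucMod i) (sym x≡y) i→y)
  ... | inj₂ (y→i , i→x) = SucModℕ-asymmetric m>2 y→i (subst (SucMod i) x≡y i→x)

  splits⇒column-injective : 2 < m → ∀ {i} p p' → column (f (i , p)) ≡ column (f (i , p')) → p ≡ p'
  splits⇒column-injective _   false false _ = refl
  splits⇒column-injective _   true  true  _ = refl
  splits⇒column-injective m>2 false true  e = ⊥-elim (splits⇒separates m>2 e)
  splits⇒column-injective m>2 true  false e = ⊥-elim (splits⇒separates m>2 (sym e))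

data Colour : Set where
  red green blue : Colour

-- Fin 4 lists 𝔽₂² as 00, 01, 10, 11, and the codes are the linear forms (a , b) ↦ a, b, a + b.
code : Colour → Fin 4 → Bool
code red   = Vec.lookup (false ∷ false ∷ true  ∷ true  ∷ [])
code green = Vec.lookup (false ∷ true  ∷ false ∷ true  ∷ [])
code blue  = Vec.lookup (false ∷ true  ∷ true  ∷ false ∷ [])

firstFin : (Fin (suc n) → Bool) → Fin (suc n)
firstFin {zero}  _ = zero
firstFin {suc n} P = if P zero then zero else suc (firstFin (P ∘ suc))

decode : Colour → Colour → Bool → Bool → Fin 4
decode κ κ' p q = firstFin λ j → does (code κ j Bool.≟ p) ∧ does (code κ' j Bool.≟ q)

Fin4-elim : {P : Fin 4 → Set} → P zero → P (suc zero) → P (suc (suc zero)) → P (suc (suc (suc zero))) → ∀ j → P j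
Fin4-elim p₀ _  _  _  zero                   = p₀
Fin4-elim _  p₁ _  _  (suc zero)             = p₁
Fin4-elim _  _  p₂ _  (suc (suc zero))       = p₂
Fin4-elim _  _  _  p₃ (suc (suc (suc zero))) = p₃

Bool²-elim : {P : Bool → Bool → Set} → P false false → P false true → P true false → P true true → ∀ p q → P p q
Bool²-elim p₀₀ _   _   _   false false = p₀₀
Bool²-elim _   p₀₁ _   _   false true  = p₀₁
Bool²-elim _   _   p₁₀ _   true  false = p₁₀
Bool²-elim _   _   _   p₁₁ true  true  = p₁₁

decode-code : ∀ {κ κ'} → κ ≢ κ' → ∀ j → decode κ κ' (code κ j) (code κ' j) ≡ j
decode-code {red}   {red}   κ≢κ' = contradiction refl κ≢κ'
decode-code {green} {green} κ≢κ' = contradiction refl κ≢κ'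
decode-code {blue}  {blue}  κ≢κ' = contradiction refl κ≢κ'
decode-code {red}   {green} _ = Fin4-elim refl refl refl refl
decode-code {red}   {blue}  _ = Fin4-elim refl refl refl refl
decode-code {green} {red}   _ = Fin4-elim refl refl refl refl
decode-code {green} {blue}  _ = Fin4-elim refl refl refl refl
decode-code {blue}  {red}   _ = Fin4-elim refl refl refl refl
decode-code {blue}  {green} _ = Fin4-elim refl refl refl refl

code-decode : ∀ {κ κ'} → κ ≢ κ' → ∀ p q → code κ (decode κ κ' p q) ≡ p × code κ' (decode κ κ' p q) ≡ q
code-decode {red}   {red}   κ≢κ' = contradiction refl κ≢κ'
code-decode {green} {green} κ≢κ' = contradiction refl κ≢κ'
code-decode {blue}  {blue}  κ≢κ' = contradiction refl κ≢κ'
code-decode {red}   {green} _ = Bool²-elim (refl , refl) (refl , refl) (refl , refl) (refl , refl)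
code-decode {red}   {blue}  _ = Bool²-elim (refl , refl) (refl , refl) (refl , refl) (refl , refl)
code-decode {green} {red}   _ = Bool²-elim (refl , refl) (refl , refl) (refl , refl) (refl , refl)
code-decode {green} {blue}  _ = Bool²-elim (refl , refl) (refl , refl) (refl , refl) (refl , refl)
code-decode {blue}  {red}   _ = Bool²-elim (refl , refl) (refl , refl) (refl , refl) (refl , refl)
code-decode {blue}  {green} _ = Bool²-elim (refl , refl) (refl , refl) (refl , refl) (refl , refl)

codes-injective : ∀ {κ κ' j j'} → κ ≢ κ' → code κ j ≡ code κ j' → code κ' j ≡ code κ' j' → j ≡ j'
codes-injective {κ} {κ'} {j} {j'} κ≢κ' at-κ at-κ' = begin
  j                                       ≡⟨ sym (decode-code κ≢κ' j) ⟩
  decode κ κ' (code κ j) (code κ' j)      ≡⟨ cong₂ (decode κ κ') at-κ at-κ' ⟩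
  decode κ κ' (code κ j') (code κ' j')    ≡⟨ decode-code κ≢κ' j' ⟩
  j'                                      ∎
  where open ≡-Reasoning

alternate : ℕ → Colour
alternate zero          = red
alternate (suc zero)    = green
alternate (suc (suc n)) = alternate n

alternate≢alternate-suc : ∀ n → alternate n ≢ alternate (suc n)
alternate≢alternate-suc zero          ()
alternate≢alternate-suc (suc zero)    ()
alternate≢alternate-suc (suc (suc n)) = alternate≢alternate-suc n

alternate≢blue : ∀ n → alternate n ≢ blue
alternate≢blue zero          ()
alternate≢blue (suc zero)    ()
alternate≢blue (suc (suc n)) = alternate≢blue n

colourℕ : ℕ → ℕ → Colour
colourℕ m x with suc x ≟ m
... | yes _ = blue
... | no _  = alternate x

colourℕ-proper : ∀ {x y} → 1 < m → y < m → SucModℕ m x y → colourℕ m x ≢ colourℕ m y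
colourℕ-proper {m} {x} _ x+1<m (inj₁ refl) with suc x ≟ m | suc (suc x) ≟ m
... | yes x+1≡m | _     = contradiction x+1<m (<-irrefl x+1≡m)
... | no _      | yes _ = alternate≢blue x
... | no _      | no _  = alternate≢alternate-suc x
colourℕ-proper {m} {x} 1<m _ (inj₂ (x+1≡m , refl)) with suc x ≟ m | 1 ≟ m
... | no x+1≢m | _       = contradiction x+1≡m x+1≢m
... | yes _    | yes 1≡m = contradiction 1<m (<-irrefl 1≡m)
... | yes _    | no _    = λ ()

colour : Fin m → Colour
colour {m} i = colourℕ m (toℕ i)

colour-proper : 1 < m → ∀ {i k : Fin m} → CycleAdj i k → colour i ≢ colour k
colour-proper 1<m {k = k} (inj₁ i→k) = colourℕ-proper 1<m (toℕ<n k) i→k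
colour-proper 1<m {i}     (inj₂ k→i) = colourℕ-proper 1<m (toℕ<n i) k→i ∘ sym

colour-code-factorization : 2 < m → {F : Digraph W} {f : HVert m → HVert m} →
                            SplitsColumns f → Isomorphic (Graph f) F → Factorization (HStarArc m) F
colour-code-factorization {m} m>2 {f = f} split iso =
  functional-factorization 4 fs (λ j → conjugate-isomorphic {f = f} (flip (mask j)) (flip-involutive (mask j)) iso)
    arcs covers separates
  where
  open ≡-Reasoning

  mask : Fin 4 → Fin m → Bool
  mask j i = code (colour i) j

  fs : Fin 4 → HVert m → HVert m
  fs j = conjugate (flip (mask j)) f

  arcs : ∀ j u → HStarArc m u (fs j u)
  arcs j u = splits⇒adjacent split (flip (mask j) u)

  covers : ∀ u v → HStarArc m u v → ∃[ j ] fs j u ≡ v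
  covers (i , b) (k , e) i~k with splits⇒reaches split i~k
  ... | p , column≡k = j , (begin
    flip (mask j) (f (i , mask j i xor b))       ≡⟨ cong (λ x → flip (mask j) (f (i , x xor b))) at-i ⟩
    flip (mask j) (f (i , (p xor b) xor b))      ≡⟨ cong (λ x → flip (mask j) (f (i , x))) (xor-involutiveʳ p b) ⟩
    flip (mask j) w                              ≡⟨ flip-at {s = mask j} column≡k ⟩
    (k , mask j k xor proj₂ w)                   ≡⟨ cong (λ x → k , x xor proj₂ w) at-k ⟩
    (k , (e xor proj₂ w) xor proj₂ w)            ≡⟨ cong (k ,_) (xor-involutiveʳ e (proj₂ w)) ⟩
    (k , e)                                      ∎)
    where
    w = f (i , p)
    j = decode (colour i) (colour k) (p xor b) (e xor proj₂ w)
    decoded = code-decode (colour-proper (<⇒≤ m>2) i~k) (p xor b) (e xor proj₂ w)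
    at-i : mask j i ≡ p xor b
    at-i = proj₁ decoded
    at-k : mask j k ≡ e xor proj₂ w
    at-k = proj₂ decoded

  separates : ∀ u {j j'} → fs j u ≡ fs j' u → j ≡ j'
  separates (i , b) {j} {j'} same =
    codes-injective (colour-proper (<⇒≤ m>2) i~k) (xor-cancelʳ same-row) (xor-cancelʳ (cong proj₂ same-w))
    where
    same-row : mask j i xor b ≡ mask j' i xor b
    same-row = splits⇒column-injective split m>2 _ _ (cong column same)
    w = f (i , mask j i xor b)
    i~k : CycleAdj i (column w)
    i~k = splits⇒adjacent split (i , mask j i xor b)
    same-w : flip (mask j) w ≡ flip (mask j') w
    same-w = trans same (cong (λ x → flip (mask j') (f (i , x))) (sym same-row))

opposite-neighbour : (i : Fin 2) → SucMod i (opposite i) × SucMod (opposite i) i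
opposite-neighbour zero       = inj₁ refl , inj₂ (refl , refl)
opposite-neighbour (suc zero) = inj₂ (refl , refl) , inj₁ refl

adjacent⇒opposite : {i k : Fin 2} → CycleAdj i k → k ≡ opposite i
adjacent⇒opposite {i} (inj₁ i→k) = SucMod-functional i→k (proj₁ (opposite-neighbour i))
adjacent⇒opposite {i} (inj₂ k→i) = SucMod-injective k→i (proj₂ (opposite-neighbour i))

two-column-factorization : {F : Digraph W} {f : HVert 2 → HVert 2} →
                           SplitsColumns f → Injective _≡_ _≡_ f → Isomorphic (Graph f) F → Factorization (HStarArc 2) F
two-column-factorization {f = f} split f-injective iso =
  functional-factorization 2 fs (λ j → conjugate-isomorphic {f = f} (flip (mask j)) (flip-involutive (mask j)) iso)
    arcs covers separates
  where
  mask : Fin 2 → Fin 2 → Bool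
  mask zero       _          = false
  mask (suc zero) zero       = true
  mask (suc zero) (suc zero) = false

  fs : Fin 2 → HVert 2 → HVert 2
  fs j = conjugate (flip (mask j)) f

  arcs : ∀ j u → HStarArc 2 u (fs j u)
  arcs j u = splits⇒adjacent split (flip (mask j) u)

  fs₁≢f : ∀ u → fs (suc zero) u ≢ f u
  fs₁≢f (zero , b) fs₁u≡fu = not-¬ refl (sym (cong proj₂ (f-injective (trans (sym unflipped) fs₁u≡fu))))
    where
    unflipped : flip (mask (suc zero)) (f (zero , not b)) ≡ f (zero , not b)
    unflipped = flip-fixes {s = mask (suc zero)} (cong (mask (suc zero)) (adjacent⇒opposite (splits⇒adjacent split (zero , not b))))
  fs₁≢f (suc zero , b) =
    flip-moves {s = mask (suc zero)} (cong (mask (suc zero)) (adjacent⇒opposite (splits⇒adjacent split (suc zero , b))))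

  covers : ∀ u v → HStarArc 2 u v → ∃[ j ] fs j u ≡ v
  covers u (k , e) u~k = by-value (e Bool.≟ proj₂ (f u))
    where
    in-column-k : ∀ j → column (fs j u) ≡ k
    in-column-k j = trans (adjacent⇒opposite (arcs j u)) (sym (adjacent⇒opposite u~k))
    fs₁u≡not-fu : proj₂ (fs (suc zero) u) ≡ not (proj₂ (f u))
    fs₁u≡not-fu = ¬-not λ same → fs₁≢f u (×-≡,≡→≡ (trans (in-column-k (suc zero)) (sym (in-column-k zero)) , same))
    by-value : Dec (e ≡ proj₂ (f u)) → ∃[ j ] fs j u ≡ (k , e)
    by-value (yes e≡fu) = zero , ×-≡,≡→≡ (in-column-k zero , sym e≡fu)
    by-value (no e≢fu)  = suc zero , ×-≡,≡→≡ (in-column-k (suc zero) , trans fs₁u≡not-fu (sym (¬-not e≢fu)))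

  separates : ∀ u {j j'} → fs j u ≡ fs j' u → j ≡ j'
  separates u {zero}     {zero}     _ = refl
  separates u {suc zero} {suc zero} _ = refl
  separates u {zero}     {suc zero} e = contradiction (sym e) (fs₁≢f u)
  separates u {suc zero} {zero}     e = contradiction e (fs₁≢f u)

split-factorization : 1 < m → {F : Digraph W} {f : HVert m → HVert m} →
                      SplitsColumns f → Injective _≡_ _≡_ f → Isomorphic (Graph f) F → Factorization (HStarArc m) F
split-factorization {suc zero} (s≤s ())
split-factorization {suc (suc zero)}    _ split f-injective = two-column-factorization split f-injective
split-factorization {suc (suc (suc _))} _ split _           = colour-code-factorization (s≤s (s≤s (s≤s z≤n))) split

-- A permutation of H_{2m} with cycle type F

-- toVertex places a position (q , true) at y_q and (q , false) at x_{q+1}.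
Position : Set
Position = ℕ × Bool

step : (ℕ → Bool) → Position → Position
step starts (q , true)  = if starts q       then (q , false) else (pred q , true)
step starts (q , false) = if starts (suc q) then (q , true)  else (suc q , false)

module _ {starts : ℕ → Bool} {q : ℕ} where

  step-y-left : starts q ≡ false → step starts (q , true) ≡ (pred q , true)
  step-y-left inner rewrite inner = refl

  step-x-turn : starts (suc q) ≡ true → step starts (q , false) ≡ (q , true)
  step-x-turn start rewrite start = refl

  step-x-right : starts (suc q) ≡ false → step starts (q , false) ≡ (suc q , false)
  step-x-right inner rewrite inner = refl

shift : ℕ → Position → Position
shift h (q , b) = h + q , b

step-shift : ∀ {starts starts' h} → (∀ q → starts' (h + q) ≡ starts q) → starts 0 ≡ true →
             ∀ p → step starts' (shift h p) ≡ shift h (step starts p)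
step-shift shifted start₀ (zero , true) rewrite shifted 0 | start₀ = refl
step-shift {starts} {h = h} shifted _ (suc q , true) rewrite shifted (suc q) with starts (suc q)
... | true  = refl
... | false = cong (λ x → pred x , true) (+-suc h q)
step-shift {starts} {h = h} shifted _ (q , false) rewrite sym (+-suc h q) | shifted (suc q) with starts (suc q)
... | true  = refl
... | false = refl

-- isStart hs q: q is a partial sum of hs, i.e. the first column of a block (or m).
isStart : List ℕ → ℕ → Bool
isStartAfter : ℕ → List ℕ → ℕ → Bool

isStart _        zero    = true
isStart []       (suc _) = false
isStart (h ∷ hs) (suc q) = isStartAfter h hs (suc q)

isStartAfter zero    hs q       = isStart hs q
isStartAfter (suc h) hs zero    = false
isStartAfter (suc h) hs (suc q) = isStartAfter h hs q

isStartAfter-+ : ∀ h hs q → isStartAfter h hs (h + q) ≡ isStart hs q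
isStartAfter-+ zero    hs q = refl
isStartAfter-+ (suc h) hs q = isStartAfter-+ h hs q

isStartAfter-< : ∀ {h r} hs → r < h → isStartAfter h hs r ≡ false
isStartAfter-< {suc h} {zero}  hs _         = refl
isStartAfter-< {suc h} {suc r} hs (s≤s r<h) = isStartAfter-< hs r<h

isStart-shift : ∀ {h hs} → 1 ≤ h → ∀ q → isStart (h ∷ hs) (h + q) ≡ isStart hs q
isStart-shift {suc h} {hs} _ q = isStartAfter-+ h hs q

isStart-inside : ∀ {h r} hs → 0 < r → r < h → isStart (h ∷ hs) r ≡ false
isStart-inside {r = suc r} hs _ r<h = isStartAfter-< hs r<h

isStart-end : ∀ {h} hs → 1 ≤ h → isStart (h ∷ hs) h ≡ true
isStart-end {h} hs h≥1 = trans (cong (isStart (h ∷ hs)) (sym (+-identityʳ h))) (isStart-shift h≥1 0)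

isStart-sum : ∀ {hs} → All (1 ≤_) hs → isStart hs (sum hs) ≡ true
isStart-sum []                     = refl
isStart-sum {h ∷ hs} (h≥1 ∷ hs≥1) = trans (isStart-shift h≥1 (sum hs)) (isStart-sum hs≥1)

-- Vertex a of a cycle of length 2h runs right along the x-row of the block, then back along the y-row.
blockPosition : ℕ → ℕ → Position
blockPosition h a with a <? h
... | yes _ = a , false
... | no _  = h ∸ suc (a ∸ h) , true

blockPosition-lower : ∀ {h a} → a < h → blockPosition h a ≡ (a , false)
blockPosition-lower {h} {a} a<h with a <? h
... | yes _   = refl
... | no a≮h = contradiction a<h a≮h

blockPosition-upper : ∀ h t → blockPosition h (h + t) ≡ (h ∸ suc t , true)
blockPosition-upper h t with h + t <? h
... | yes h+t<h = contradiction h+t<h (m+n≮m h t)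
... | no _      = cong (λ x → h ∸ suc x , true) (m+n∸m≡n h t)

data Half (h : ℕ) : ℕ → Set where
  lower : ∀ {a} → a < h → Half h a
  upper : ∀ t → Half h (h + t)

half : ∀ h a → Half h a
half h a with a <? h
... | yes a<h = lower a<h
... | no a≮h with m≤n⇒∃[o]m+o≡n (≮⇒≥ a≮h)
...   | t , refl = upper t

blockPosition-bound : ∀ h {a} → a < h + h → proj₁ (blockPosition h a) < h
blockPosition-bound h {a} a<2h with half h a
... | lower a<h rewrite blockPosition-lower a<h = a<h
... | upper t   rewrite blockPosition-upper h t = ∸-monoʳ-< z<s (+-cancelˡ-< h t h a<2h)

blockPosition-injective : ∀ h {a a'} → a < h + h → a' < h + h → blockPosition h a ≡ blockPosition h a' → a ≡ a'
blockPosition-injective h {a} {a'} a<2h a'<2h same with half h a | half h a'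
... | lower a<h | lower a'<h = cong proj₁ (trans (sym (blockPosition-lower a<h)) (trans same (blockPosition-lower a'<h)))
... | lower a<h | upper t'   = contradiction (cong proj₂ (trans (sym (blockPosition-lower a<h)) (trans same (blockPosition-upper h t')))) λ ()
... | upper t   | lower a'<h = contradiction (cong proj₂ (trans (sym (blockPosition-upper h t)) (trans same (blockPosition-lower a'<h)))) λ ()
... | upper t   | upper t'   = cong (h +_) (suc-injective (∸-cancelˡ-≡ (+-cancelˡ-< h t h a<2h) (+-cancelˡ-< h t' h a'<2h)
                                 (cong proj₁ (trans (sym (blockPosition-upper h t)) (trans same (blockPosition-upper h t'))))))

blockPosition-surjective : ∀ h {q} b → q < h → Σ (Fin (h + h)) λ a → blockPosition h (toℕ a) ≡ (q , b)
blockPosition-surjective h false q<h =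
  fromℕ< (<-≤-trans q<h (m≤m+n h h)) , trans (cong (blockPosition h) (toℕ-fromℕ< _)) (blockPosition-lower q<h)
blockPosition-surjective h {q} true q<h =
  fromℕ< (+-monoʳ-< h (∸-monoʳ-< z<s q<h)) ,
  trans (cong (blockPosition h) (toℕ-fromℕ< _)) (trans (blockPosition-upper h (h ∸ suc q)) (cong (_, true) reflect-reflect))
  where
  reflect-reflect : h ∸ suc (h ∸ suc q) ≡ q
  reflect-reflect = trans (sym (pred[m∸n]≡m∸[1+n] h (h ∸ suc q))) (cong pred (m∸[m∸n]≡n q<h))

blockPosition-step-x : ∀ {hs h a} → 1 ≤ h → a < h →
                       blockPosition h (suc a) ≡ step (isStart (h ∷ hs)) (blockPosition h a)
blockPosition-step-x {hs} {h} {a} h≥1 a<h with m≤n⇒m<n∨m≡n a<h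
... | inj₁ a+1<h = begin
  blockPosition h (suc a)          ≡⟨ blockPosition-lower a+1<h ⟩
  (suc a , false)                  ≡⟨ sym (step-x-right {starts = starts} (isStart-inside hs z<s a+1<h)) ⟩
  step starts (a , false)          ≡⟨ cong (step starts) (sym (blockPosition-lower a<h)) ⟩
  step starts (blockPosition h a)  ∎
  where
  open ≡-Reasoning
  starts = isStart (h ∷ hs)
... | inj₂ refl = begin
  blockPosition (suc a) (suc a)          ≡⟨ cong (blockPosition (suc a)) (sym (+-identityʳ (suc a))) ⟩
  blockPosition (suc a) (suc a + 0)      ≡⟨ blockPosition-upper (suc a) 0 ⟩
  (a , true)                             ≡⟨ sym (step-x-turn {starts = starts} (isStart-end hs h≥1)) ⟩
  step starts (a , false)                ≡⟨ cong (step starts) (sym (blockPosition-lower a<h)) ⟩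
  step starts (blockPosition (suc a) a)  ∎
  where
  open ≡-Reasoning
  starts = isStart (suc a ∷ hs)

blockPosition-step-y : ∀ {hs h t} → suc t < h →
                       blockPosition h (suc (h + t)) ≡ step (isStart (h ∷ hs)) (blockPosition h (h + t))
blockPosition-step-y {hs} {h} {t} t+1<h = begin
  blockPosition h (suc (h + t))          ≡⟨ cong (blockPosition h) (sym (+-suc h t)) ⟩
  blockPosition h (h + suc t)            ≡⟨ blockPosition-upper h (suc t) ⟩
  (h ∸ suc (suc t) , true)               ≡⟨ cong (_, true) (sym (pred[m∸n]≡m∸[1+n] h (suc t))) ⟩
  (pred (h ∸ suc t) , true)              ≡⟨ sym (step-y-left {starts = starts} inside) ⟩
  step starts (h ∸ suc t , true)         ≡⟨ cong (step starts) (sym (blockPosition-upper h t)) ⟩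
  step starts (blockPosition h (h + t))  ∎
  where
  open ≡-Reasoning
  starts = isStart (h ∷ hs)
  inside : starts (h ∸ suc t) ≡ false
  inside = isStart-inside hs (m<n⇒0<n∸m t+1<h) (∸-monoʳ-< z<s (<⇒≤ t+1<h))

blockPosition-closes : ∀ {hs h} →
                       blockPosition (suc h) 0 ≡ step (isStart (suc h ∷ hs)) (blockPosition (suc h) (suc h + h))
blockPosition-closes {hs} {h} = begin
  blockPosition (suc h) 0                          ≡⟨ blockPosition-lower {suc h} z<s ⟩
  (0 , false)                                      ≡⟨ cong (λ x → step starts (x , true)) (sym (n∸n≡0 h)) ⟩
  step starts (h ∸ h , true)                       ≡⟨ cong (step starts) (sym (blockPosition-upper (suc h) h)) ⟩
  step starts (blockPosition (suc h) (suc h + h))  ∎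
  where
  open ≡-Reasoning
  starts = isStart (suc h ∷ hs)

blockPosition-step : ∀ {hs h a t} → 1 ≤ h → t < h + h → SucModℕ (h + h) a t →
                     blockPosition h t ≡ step (isStart (h ∷ hs)) (blockPosition h a)
blockPosition-step {hs} {suc h} {a} _ _ (inj₂ (wrap , refl)) =
  trans (blockPosition-closes {hs} {h}) (cong (step (isStart (suc h ∷ hs)) ∘ blockPosition (suc h)) last)
  where
  last : suc h + h ≡ a
  last = sym (trans (suc-injective wrap) (+-suc h h))
blockPosition-step {h = h} {a} h≥1 a+1<2h (inj₁ refl) with half h a
... | lower a<h = blockPosition-step-x h≥1 a<h
... | upper t   = blockPosition-step-y (+-cancelˡ-< h (suc t) h (subst (_< h + h) (sym (+-suc h t)) a+1<2h))

double : ℕ → ℕ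
double h = h + h

position : (hs : List ℕ) → FVert (map double hs) → Position
position (h ∷ hs) (zero  , a) = blockPosition h (toℕ a)
position (h ∷ hs) (suc k , a) = shift h (position hs (k , a))

position-next : ∀ {hs} → All (1 ≤_) hs → ∀ v → position hs (next {map double hs} v) ≡ step (isStart hs) (position hs v)
position-next (h≥1 ∷ _) (zero , a) = blockPosition-step h≥1 (toℕ<n (sucMod a)) (SucMod-sucMod a)
position-next {h ∷ hs} (h≥1 ∷ hs≥1) (suc k , a) =
  trans (cong (shift h) (position-next hs≥1 (k , a))) (sym (step-shift (isStart-shift h≥1) refl (position hs (k , a))))

position-bound : ∀ hs v → proj₁ (position hs v) < sum hs
position-bound (h ∷ hs) (zero  , a) = <-≤-trans (blockPosition-bound h (toℕ<n a)) (m≤m+n h (sum hs))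
position-bound (h ∷ hs) (suc k , a) = +-monoʳ-< h (position-bound hs (k , a))

position-injective : ∀ hs {v v'} → position hs v ≡ position hs v' → v ≡ v'
position-injective (h ∷ hs) {zero , a} {zero , a'} same =
  cong (zero ,_) (toℕ-injective (blockPosition-injective h (toℕ<n a) (toℕ<n a') same))
position-injective (h ∷ hs) {zero , a} {suc _ , _} same =
  contradiction (subst (_< h) (cong proj₁ same) (blockPosition-bound h (toℕ<n a))) (m+n≮m h _)
position-injective (h ∷ hs) {suc _ , _} {zero , a'} same =
  contradiction (subst (_< h) (cong proj₁ (sym same)) (blockPosition-bound h (toℕ<n a'))) (m+n≮m h _)
position-injective (h ∷ hs) {suc k , a} {suc k' , a'} same
  with position-injective hs (×-≡,≡→≡ (+-cancelˡ-≡ h _ _ (cong proj₁ same) , cong proj₂ same))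
... | refl = refl

position-surjective : ∀ hs {q} b → q < sum hs → ∃[ v ] position hs v ≡ (q , b)
position-surjective (h ∷ hs) {q} b q<sum with half h q
... | lower q<h with blockPosition-surjective h b q<h
...   | a , at-a = (zero , a) , at-a
position-surjective (h ∷ hs) b h+t<sum | upper t
  with position-surjective hs b (+-cancelˡ-< h t (sum hs) h+t<sum)
... | (k , a) , at-ka = (suc k , a) , cong (shift h) at-ka

module Placement (m : ℕ) .{{_ : NonZero m}} where

  toVertex : Position → HVert m
  toVertex (q , true)  = q mod m , true
  toVertex (q , false) = suc q mod m , false

  cyclicPred : ℕ → ℕ
  cyclicPred zero    = pred m
  cyclicPred (suc x) = x

  fromVertex : HVert m → Position
  fromVertex (i , true)  = toℕ i , true
  fromVertex (i , false) = cyclicPred (toℕ i) , false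

  SucModℕ-cyclicPred : ∀ {x} → x < m → SucModℕ m (cyclicPred x) x
  SucModℕ-cyclicPred {zero}  _ = inj₂ (suc-pred m , refl)
  SucModℕ-cyclicPred {suc x} _ = inj₁ refl

  cyclicPred-< : ∀ {x} → x < m → cyclicPred x < m
  cyclicPred-< {zero}  _     = m≤pred[n]⇒suc[m]≤n ≤-refl
  cyclicPred-< {suc x} x+1<m = <-trans (n<1+n x) x+1<m

  fromVertex-bound : ∀ u → proj₁ (fromVertex u) < m
  fromVertex-bound (i , true)  = toℕ<n i
  fromVertex-bound (i , false) = cyclicPred-< (toℕ<n i)

  fromVertex-toVertex : ∀ p → proj₁ p < m → fromVertex (toVertex p) ≡ p
  fromVertex-toVertex (q , true)  q<m = cong (_, true) (toℕ-mod q<m)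
  fromVertex-toVertex (q , false) q<m =
    cong (_, false) (SucModℕ-injective (SucModℕ-cyclicPred (toℕ<n (suc q mod m))) (SucModℕ-mod q<m))

  toVertex-fromVertex : ∀ u → toVertex (fromVertex u) ≡ u
  toVertex-fromVertex (i , true)  = cong (_, true) (toℕ-injective (toℕ-mod (toℕ<n i)))
  toVertex-fromVertex (i , false) = cong (_, false) (toℕ-injective
    (SucModℕ-functional (toℕ<n _) (toℕ<n i) (SucModℕ-mod (cyclicPred-< (toℕ<n i))) (SucModℕ-cyclicPred (toℕ<n i))))

module BlockPermutation {m : ℕ} .{{_ : NonZero m}} {hs : List ℕ} (hs≥1 : All (1 ≤_) hs) (sum≡m : sum hs ≡ m) where
  open Placement m

  starts : ℕ → Bool
  starts = isStart hs

  permutation : HVert m → HVert m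
  permutation = toVertex ∘ step starts ∘ fromVertex

  position-< : ∀ v → proj₁ (position hs v) < m
  position-< v = subst (_ <_) sum≡m (position-bound hs v)

  embedding : FVert (map double hs) ⤖ HVert m
  embedding = mk⤖ (injective , strictlySurjective⇒surjective surjective)
    where
    open ≡-Reasoning
    injective : Injective _≡_ _≡_ (toVertex ∘ position hs)
    injective {v} {v'} same = position-injective hs (begin
      position hs v                         ≡⟨ sym (fromVertex-toVertex _ (position-< v)) ⟩
      fromVertex (toVertex (position hs v))  ≡⟨ cong fromVertex same ⟩
      fromVertex (toVertex (position hs v')) ≡⟨ fromVertex-toVertex _ (position-< v') ⟩
      position hs v'                        ∎)
    surjective : ∀ u → ∃[ v ] toVertex (position hs v) ≡ u
    surjective u with position-surjective hs (proj₂ (fromVertex u)) (subst (_ <_) (sym sum≡m) (fromVertex-bound u))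
    ... | v , at-v = v , trans (cong toVertex at-v) (toVertex-fromVertex u)

  permutation-intertwines : ∀ v → permutation (Bijection.to embedding v) ≡ Bijection.to embedding (next {map double hs} v)
  permutation-intertwines v = begin
    toVertex (step starts (fromVertex (toVertex (position hs v)))) ≡⟨ cong (toVertex ∘ step starts) (fromVertex-toVertex (position hs v) (position-< v)) ⟩
    toVertex (step starts (position hs v))                         ≡⟨ cong toVertex (sym (position-next hs≥1 v)) ⟩
    toVertex (position hs (next {map double hs} v))                ∎
    where open ≡-Reasoning

  permutation-isomorphic : Isomorphic (Graph permutation) (FArc (map double hs))
  permutation-isomorphic = intertwining-isomorphic {f = permutation} embedding permutation-intertwines

  permutation-injective : Injective _≡_ _≡_ permutation
  permutation-injective = intertwining-injective {ms = map double hs} {f = permutation} embedding permutation-intertwines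

  column-of : Position → ℕ
  column-of p = toℕ (column (toVertex p))

  starts-cyclicPred : ∀ x → starts (suc (cyclicPred x)) ≡ starts x
  starts-cyclicPred zero    = trans (cong starts (trans (suc-pred m) (sym sum≡m))) (isStart-sum hs≥1)
  starts-cyclicPred (suc x) = refl

  SplitsAt : ℕ → Set
  SplitsAt x = Betweenℕ m (column-of (step starts (cyclicPred x , false))) x (column-of (step starts (x , true)))

  splits-at-start : ∀ {x} → x < m → starts x ≡ true → SplitsAt x
  splits-at-start {x} x<m start rewrite start | trans (starts-cyclicPred x) start =
    inj₁ (subst (λ y → SucModℕ m y x) (sym (toℕ-mod (cyclicPred-< x<m))) (SucModℕ-cyclicPred x<m) , SucModℕ-mod x<m)

  splits-inside : ∀ {x} → suc x < m → starts (suc x) ≡ false → SplitsAt (suc x)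
  splits-inside {x} x+1<m inner rewrite inner =
    inj₂ (subst (λ y → SucModℕ m y (suc x)) (sym (toℕ-mod (<-trans (n<1+n x) x+1<m))) (inj₁ refl) , SucModℕ-mod x+1<m)

  splits-at : ∀ {x} → x < m → SplitsAt x
  splits-at {zero}  0<m   = splits-at-start 0<m refl
  splits-at {suc x} x+1<m = by-start (starts (suc x)) refl
    where
    by-start : ∀ b → starts (suc x) ≡ b → SplitsAt (suc x)
    by-start true  start = splits-at-start x+1<m start
    by-start false inner = splits-inside x+1<m inner

  permutation-splits : SplitsColumns permutation
  permutation-splits = splits λ i → splits-at (toℕ<n i)

double≡2* : ∀ h → double h ≡ 2 * h
double≡2* h = cong (h +_) (sym (+-identityʳ h))

sum-map-double : ∀ hs → sum (map double hs) ≡ 2 * sum hs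
sum-map-double []       = refl
sum-map-double (h ∷ hs) = begin
  double h + sum (map double hs)  ≡⟨ cong₂ _+_ (double≡2* h) (sum-map-double hs) ⟩
  2 * h + 2 * sum hs              ≡⟨ sym (*-distribˡ-+ 2 h (sum hs)) ⟩
  2 * (h + sum hs)                ∎
  where open ≡-Reasoning

halve : ∀ {ms} → Is2FactorType ms → IsBipartite ms → ∃[ hs ] All (1 ≤_) hs × ms ≡ map double hs
halve []             []                           = [] , [] , refl
halve (2≤h*2 ∷ ms≥2) (divides h refl ∷ ms-even) with halve ms≥2 ms-even
... | hs , hs≥1 , refl =
  h ∷ hs , positive 2≤h*2 ∷ hs≥1 , cong (_∷ map double hs) (trans (*-comm h 2) (sym (double≡2* h)))
  where
  positive : ∀ {h} → 2 ≤ h * 2 → 1 ≤ h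
  positive {zero}  ()
  positive {suc h} _ = s≤s z≤n

theorem3p4 : (m : ℕ) → 1 < m → (ms : List ℕ) → Is2FactorType ms → IsBipartite ms → sum ms ≡ 2 * m → Factorization (HStarArc m) (FArc ms)
theorem3p4 m 1<m ms ms≥2 ms-even sum≡2m with halve ms≥2 ms-even
... | hs , hs≥1 , refl =
  split-factorization 1<m permutation-splits permutation-injective permutation-isomorphic
  where
  instance
    m≢0 : NonZero m
    m≢0 = >-nonZero (<-trans z<s 1<m)
  sum≡m : sum hs ≡ m
  sum≡m = *-cancelˡ-≡ (sum hs) m 2 (trans (sym (sum-map-double hs)) sum≡2m)
  open BlockPermutation hs≥1 sum≡m
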